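{- Let $x$ and $t$ be positive integers and let $n=\prod_{i=1}^{s}p_i^{k_i}$ with $p_1,\dots,p_s$ distinct primes and $k_i\ge1$. For each $1\le j\le s$, $$\frac{\sigma_x(n)+t}{n^x}<I(x,p_jn)\quad\text{if and only if}\quad p_j^x<\frac{1}{t}\,\sigma_x\!\left(\frac{n}{p_j^{k_j}}\right).$$
   Context: For positive integers $x,n$, $\sigma_x(n)=\sum_{d\mid n} d^x$ and $I(x,n)=\sigma_x(n)/n^x$. -}

module Defs where

open import Data.Nat using (ℕ; zero; suc; _+_; _*_; _^_)
open import Data.Nat.Divisibility using (_∣?_)
open import Data.List using (List; filter; map; upTo)
open import Data.Nat.ListAction using (sum)
import Data.Nat as ℕ
open import Data.Integer using (+_)
open import Data.Rational using (ℚ; _/_)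

-- list of the divisors of n (for n ≥ 1): all d ∈ {0,…,n} with d ∣ n.
-- (for n = 0 this would contain only 0; it is never used with n = 0 here)
divisors : ℕ → List ℕ
divisors n = filter (_∣? n) (upTo (suc n))

σ : ℕ → ℕ → ℕ
σ x n = sum (map (λ d → d ^ x) (divisors n))

-- the rational a / d, with the convention a / 0 = 0 (only used with d ≥ 1)
_÷ℕ_ : ℕ → ℕ → ℚ
a ÷ℕ zero = + 0 / 1
a ÷ℕ suc d = + a / suc d

I : ℕ → ℕ → ℚ
I x n = σ x n ÷ℕ (n ^ x)

-- natural-number quotient a / d, with the convention a / 0 = 0 (only used with d ≥ 1)
_divℕ_ : ℕ → ℕ → ℕ
a divℕ zero = 0
a divℕ suc d = a ℕ./ suc d

-- Write n = q^K · R with q prime and q ∤ R.  The divisors of q·n split into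
-- those divisible by q, which are exactly q·e for the divisors e of n, and
-- those prime to q, which are exactly the divisors of R.  Hence
--     σ_x(q·n) = q^x · σ_x(n) + σ_x(R).                            (★)
-- Clearing the (positive) denominators n^x and (q·n)^x = q^x·n^x, the
-- inequality (σ_x(n) + t)/n^x < σ_x(q·n)/(q·n)^x becomes, by (★),
--     q^x·σ_x(n) + q^x·t < q^x·σ_x(n) + σ_x(R),  i.e.  q^x·t < σ_x(R),
-- which is exactly q^x < σ_x(R)/t; and R = n / q^K.
module Submission where

open import Defs
open import Data.Nat
  using (ℕ; zero; suc; _+_; _*_; _^_; _≤_; _<_; s≤s; NonZero; ≢-nonZero; >-nonZero; nonTrivial⇒≢1)
open import Data.Nat.Properties
open import Data.Nat.Divisibility
open import Data.Nat.DivMod using (_/_; m*n/n≡m)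
open import Data.Nat.Coprimality using (Coprime; coprime-divisor)
open import Data.Nat.Primality
  using (Prime; prime⇒irreducible; prime⇒nonZero; prime⇒nonTrivial; euclidsLemma)
open import Data.Nat.ListAction using (sum)
open import Data.Nat.Solver using (module +-*-Solver)
open import Data.List using (_∷_; filter; map; applyUpTo)
open import Data.Bool using (true; false; if_then_else_)
open import Data.Fin using (Fin) renaming (zero to fzero; suc to fsuc)
import Data.Fin.Properties as Fin
open import Data.Vec.Functional using (Vector; foldr)
open import Data.Product using (Σ-syntax; _×_; _,_)
open import Data.Sum using (inj₁; inj₂)
open import Data.Empty using (⊥-elim)
import Data.Integer as ℤ
import Data.Integer.Properties as ℤₚ
import Data.Rational as ℚ
import Data.Rational.Properties as ℚₚ
import Data.Rational.Unnormalised as ℚᵘ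
import Data.Rational.Unnormalised.Properties as ℚᵘₚ
open import Relation.Nullary using (yes; no; does)
open import Relation.Unary using (Pred; Decidable)
open import Relation.Binary.PropositionalEquality
open import Function.Base using (_∘_)
open import Function.Bundles using (_⇔_; mk⇔)
open import Function.Definitions using (Injective)
open import Function.Properties.Equivalence using (⇔-setoid)
open import Level using (0ℓ)
import Relation.Binary.Reasoning.Setoid as SetoidReasoning

open +-*-Solver

sumBelow : (ℕ → ℕ) → ℕ → ℕ
sumBelow f zero    = 0
sumBelow f (suc N) = sumBelow f N + f N

sumBelow-first : ∀ f N → sumBelow f (suc N) ≡ f 0 + sumBelow (λ i → f (suc i)) N
sumBelow-first f zero    = +-comm 0 (f 0)
sumBelow-first f (suc N) rewrite sumBelow-first f N =
  +-assoc (f 0) (sumBelow (λ i → f (suc i)) N) (f (suc N))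

sumBelow-cong : ∀ {f g} N → (∀ i → i < N → f i ≡ g i) → sumBelow f N ≡ sumBelow g N
sumBelow-cong zero    f≡g = refl
sumBelow-cong (suc N) f≡g =
  cong₂ _+_ (sumBelow-cong N (λ i i<N → f≡g i (m≤n⇒m≤1+n i<N))) (f≡g N ≤-refl)

sumBelow-+ : ∀ f g N → sumBelow (λ i → f i + g i) N ≡ sumBelow f N + sumBelow g N
sumBelow-+ f g zero    = refl
sumBelow-+ f g (suc N) rewrite sumBelow-+ f g N =
  solve 4 (λ a b c d → (a :+ b) :+ (c :+ d) := (a :+ c) :+ (b :+ d)) refl
    (sumBelow f N) (sumBelow g N) (f N) (g N)

sumBelow-scale : ∀ c f N → sumBelow (λ i → c * f i) N ≡ c * sumBelow f N
sumBelow-scale c f zero    = sym (*-zeroʳ c)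
sumBelow-scale c f (suc N) rewrite sumBelow-scale c f N = sym (*-distribˡ-+ c (sumBelow f N) (f N))

sumBelow-zeros : ∀ f N → (∀ i → i < N → f i ≡ 0) → sumBelow f N ≡ 0
sumBelow-zeros f N f≡0 = trans (sumBelow-cong N f≡0) (zeros N)
  where
  zeros : ∀ M → sumBelow (λ _ → 0) M ≡ 0
  zeros zero    = refl
  zeros (suc M) = cong (_+ 0) (zeros M)

sumBelow-split : ∀ f a b → sumBelow f (a + b) ≡ sumBelow f a + sumBelow (λ r → f (a + r)) b
sumBelow-split f a zero    rewrite +-identityʳ a = sym (+-identityʳ (sumBelow f a))
sumBelow-split f a (suc b) rewrite +-suc a b | sumBelow-split f a b =
  +-assoc (sumBelow f a) _ (f (a + b))

sumBelow-extend : ∀ f N M → N ≤ M → (∀ i → N ≤ i → f i ≡ 0) → sumBelow f M ≡ sumBelow f N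
sumBelow-extend f N M N≤M f≡0 with m≤n⇒∃[o]m+o≡n N≤M
... | o , refl = begin
    sumBelow f (N + o)                                ≡⟨ sumBelow-split f N o ⟩
    sumBelow f N + sumBelow (λ r → f (N + r)) o       ≡⟨ cong (sumBelow f N +_) tail≡0 ⟩
    sumBelow f N + 0                                  ≡⟨ +-identityʳ _ ⟩
    sumBelow f N                                      ∎
  where
  open ≡-Reasoning
  tail≡0 : sumBelow (λ r → f (N + r)) o ≡ 0
  tail≡0 = sumBelow-zeros _ o (λ r _ → f≡0 (N + r) (m≤m+n N r))

sumBelow-stride : ∀ q .{{_ : NonZero q}} f N → (∀ d → q ∤ d → f d ≡ 0) →
  sumBelow f (q * N) ≡ sumBelow (λ e → f (q * e)) N
sumBelow-stride q f zero    _   rewrite *-zeroʳ q = refl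
sumBelow-stride q@(suc q-1) f (suc N) off = begin
    sumBelow f (q * suc N)
  ≡⟨ cong (sumBelow f) (trans (*-suc q N) (+-comm q (q * N))) ⟩
    sumBelow f (q * N + q)
  ≡⟨ sumBelow-split f (q * N) q ⟩
    sumBelow f (q * N) + sumBelow (λ r → f (q * N + r)) q
  ≡⟨ cong₂ _+_ (sumBelow-stride q f N off) block ⟩
    sumBelow (λ e → f (q * e)) N + f (q * N)
  ∎
  where
  open ≡-Reasoning
  -- In the block q·N, …, q·N + q - 1 only the first entry is a multiple of q.
  block : sumBelow (λ r → f (q * N + r)) q ≡ f (q * N)
  block = begin
      sumBelow (λ r → f (q * N + r)) q
    ≡⟨ sumBelow-first _ q-1 ⟩
      f (q * N + 0) + sumBelow (λ r → f (q * N + suc r)) q-1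
    ≡⟨ cong₂ _+_ (cong f (+-identityʳ (q * N))) rest≡0 ⟩
      f (q * N) + 0
    ≡⟨ +-identityʳ _ ⟩
      f (q * N)
    ∎
    where
    rest≡0 : sumBelow (λ r → f (q * N + suc r)) q-1 ≡ 0
    rest≡0 = sumBelow-zeros _ q-1 λ r r<q-1 → off _ λ q∣ →
      >⇒∤ (s≤s r<q-1) (∣m+n∣m⇒∣n q∣ (m∣m*n N))

sum-map-filter : ∀ {ℓ} {P : Pred ℕ ℓ} (P? : Decidable P) (g h : ℕ → ℕ) N →
  sum (map g (filter P? (applyUpTo h N)))
    ≡ sumBelow (λ i → if does (P? (h i)) then g (h i) else 0) N
sum-map-filter P? g h zero    = refl
sum-map-filter P? g h (suc N) = begin
    sum (map g (filter P? (h 0 ∷ applyUpTo (h ∘ suc) N)))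
  ≡⟨ head (h 0) (applyUpTo (h ∘ suc) N) ⟩
    weight (h 0) + sum (map g (filter P? (applyUpTo (h ∘ suc) N)))
  ≡⟨ cong (weight (h 0) +_) (sum-map-filter P? g (h ∘ suc) N) ⟩
    weight (h 0) + sumBelow (weight ∘ h ∘ suc) N
  ≡⟨ sumBelow-first (weight ∘ h) N ⟨
    sumBelow (weight ∘ h) (suc N)
  ∎
  where
  open ≡-Reasoning
  weight : ℕ → ℕ
  weight a = if does (P? a) then g a else 0
  head : ∀ a as → sum (map g (filter P? (a ∷ as))) ≡ weight a + sum (map g (filter P? as))
  head a as with does (P? a)
  ... | true  = refl
  ... | false = refl

divisorTerm : ℕ → ℕ → ℕ → ℕ
divisorTerm x n d = if does (d ∣? n) then d ^ x else 0

divisorTerm-large : ∀ x n .{{_ : NonZero n}} d → n < d → divisorTerm x n d ≡ 0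
divisorTerm-large x n d n<d with d ∣? n
... | yes d∣n = ⊥-elim (>⇒∤ n<d d∣n)
... | no  _   = refl

σ-as-sumBelow : ∀ x n .{{_ : NonZero n}} M → n < M → σ x n ≡ sumBelow (divisorTerm x n) M
σ-as-sumBelow x n M n<M = begin
    σ x n
  ≡⟨ sum-map-filter (_∣? n) (_^ x) (λ d → d) (suc n) ⟩
    sumBelow (divisorTerm x n) (suc n)
  ≡⟨ sumBelow-extend _ (suc n) M n<M (λ d → divisorTerm-large x n d) ⟨
    sumBelow (divisorTerm x n) M
  ∎
  where open ≡-Reasoning

^-distribʳ-* : ∀ a b x → (a * b) ^ x ≡ a ^ x * b ^ x
^-distribʳ-* a b zero    = refl
^-distribʳ-* a b (suc x) rewrite ^-distribʳ-* a b x = [m*n]*[o*p]≡[m*o]*[n*p] a b (a ^ x) (b ^ x)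

prime∤1 : ∀ {q} → Prime q → q ∤ 1
prime∤1 q-prime q∣1 = nonTrivial⇒≢1 {{prime⇒nonTrivial q-prime}} (∣1⇒≡1 q∣1)

prime∤-* : ∀ {q a b} → Prime q → q ∤ a → q ∤ b → q ∤ a * b
prime∤-* {a = a} {b} q-prime q∤a q∤b q∣ab with euclidsLemma a b q-prime q∣ab
... | inj₁ q∣a = q∤a q∣a
... | inj₂ q∣b = q∤b q∣b

prime∤-^ : ∀ {q r} → Prime q → q ∤ r → ∀ m → q ∤ r ^ m
prime∤-^ q-prime q∤r zero    = prime∤1 q-prime
prime∤-^ q-prime q∤r (suc m) = prime∤-* q-prime q∤r (prime∤-^ q-prime q∤r m)

prime∤prime : ∀ {q r} → Prime q → Prime r → q ≢ r → q ∤ r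
prime∤prime q-prime r-prime q≢r q∣r with prime⇒irreducible r-prime q∣r
... | inj₁ refl = prime∤1 q-prime ∣-refl
... | inj₂ q≡r  = q≢r q≡r

prime∤-product : ∀ {q} → Prime q → ∀ {s} (f : Vector ℕ s) → (∀ i → q ∤ f i) →
  q ∤ foldr _*_ 1 f
prime∤-product q-prime {zero}  f q∤f = prime∤1 q-prime
prime∤-product q-prime {suc s} f q∤f =
  prime∤-* q-prime (q∤f fzero) (prime∤-product q-prime (f ∘ fsuc) (q∤f ∘ fsuc))

∣-^*-cancel : ∀ {q d} → Prime q → q ∤ d → ∀ m R → d ∣ q ^ m * R → d ∣ R
∣-^*-cancel q-prime q∤d zero    R d∣qᵐR = subst (_ ∣_) (*-identityˡ R) d∣qᵐR
∣-^*-cancel {q} {d} q-prime q∤d (suc m) R d∣qᵐR =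
  ∣-^*-cancel q-prime q∤d m R
    (coprime-divisor d⊥q (subst (d ∣_) (*-assoc q (q ^ m) R) d∣qᵐR))
  where
  d⊥q : Coprime d q
  d⊥q (c∣d , c∣q) with prime⇒irreducible q-prime c∣q
  ... | inj₁ c≡1 = c≡1
  ... | inj₂ refl = ⊥-elim (q∤d c∣d)

split-prime-power : ∀ {s} (p k : Fin s → ℕ) → (∀ i → Prime (p i)) → Injective _≡_ _≡_ p →
  ∀ j →
  Σ[ R ∈ ℕ ] (foldr _*_ 1 (λ i → p i ^ k i) ≡ p j ^ k j * R) × p j ∤ R
split-prime-power p k p-prime p-inj fzero =
  _ , refl , prime∤-product (p-prime fzero) _ p₀∤
  where
  p₀∤ : ∀ i → p fzero ∤ p (fsuc i) ^ k (fsuc i)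
  p₀∤ i = prime∤-^ (p-prime fzero)
    (prime∤prime (p-prime fzero) (p-prime (fsuc i)) (Fin.0≢1+n ∘ p-inj)) (k (fsuc i))
split-prime-power p k p-prime p-inj (fsuc j)
  with R , tail≡ , pⱼ∤R ←
         split-prime-power (p ∘ fsuc) (k ∘ fsuc) (p-prime ∘ fsuc) (Fin.suc-injective ∘ p-inj) j
  = p₀ᵏ * R , product≡ , prime∤-* (p-prime (fsuc j)) pⱼ∤p₀ᵏ pⱼ∤R
  where
  p₀ᵏ : ℕ
  p₀ᵏ = p fzero ^ k fzero
  pⱼ∤p₀ᵏ : p (fsuc j) ∤ p₀ᵏ
  pⱼ∤p₀ᵏ = prime∤-^ (p-prime (fsuc j))
    (prime∤prime (p-prime (fsuc j)) (p-prime fzero) (Fin.0≢1+n ∘ sym ∘ p-inj)) (k fzero)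
  product≡ : p₀ᵏ * foldr _*_ 1 (λ i → p (fsuc i) ^ k (fsuc i))
             ≡ p (fsuc j) ^ k (fsuc j) * (p₀ᵏ * R)
  product≡ = trans (cong (p₀ᵏ *_) tail≡)
    (solve 3 (λ a b c → a :* (b :* c) := b :* (a :* c)) refl p₀ᵏ (p (fsuc j) ^ k (fsuc j)) R)

module PrimeMultiple (x : ℕ) {q : ℕ} (q-prime : Prime q) (K R : ℕ) (q∤R : q ∤ R) where
  open ≡-Reasoning

  n : ℕ
  n = q ^ K * R

  instance
    q≢0 : NonZero q
    q≢0 = prime⇒nonZero q-prime
    R≢0 : NonZero R
    R≢0 = ≢-nonZero λ { refl → q∤R (q ∣0) }
    qᴷ≢0 : NonZero (q ^ K)
    qᴷ≢0 = m^n≢0 q K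
    n≢0 : NonZero n
    n≢0 = m*n≢0 (q ^ K) R
    qn≢0 : NonZero (q * n)
    qn≢0 = m*n≢0 q n

  -- All divisors of q·n, n and R lie below this bound.
  M : ℕ
  M = q * suc n

  qn<M : q * n < M
  qn<M = *-monoʳ-< q (n<1+n n)

  R<M : R < M
  R<M = ≤-<-trans (m≤n*m R (q ^ K)) (≤-<-trans (m≤n*m n q) qn<M)

  byQ primeToQ : ℕ → ℕ
  byQ      d = if does (q ∣? d) then divisorTerm x (q * n) d else 0
  primeToQ d = if does (q ∣? d) then 0 else divisorTerm x (q * n) d

  split-term : ∀ d → divisorTerm x (q * n) d ≡ byQ d + primeToQ d
  split-term d with q ∣? d
  ... | yes _ = sym (+-identityʳ _)
  ... | no  _ = refl

  byQ-off : ∀ d → q ∤ d → byQ d ≡ 0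
  byQ-off d q∤d with q ∣? d
  ... | yes q∣d = ⊥-elim (q∤d q∣d)
  ... | no  _   = refl

  byQ-multiple : ∀ e → byQ (q * e) ≡ q ^ x * divisorTerm x n e
  byQ-multiple e with q ∣? q * e
  ... | no q∤qe = ⊥-elim (q∤qe (m∣m*n e))
  ... | yes _ with q * e ∣? q * n | e ∣? n
  ...   | yes _     | yes _    = ^-distribʳ-* q e x
  ...   | yes qe∣qn | no e∤n   = ⊥-elim (e∤n (*-cancelˡ-∣ q qe∣qn))
  ...   | no qe∤qn  | yes e∣n  = ⊥-elim (qe∤qn (*-monoʳ-∣ q e∣n))
  ...   | no _      | no _     = sym (*-zeroʳ (q ^ x))

  primeToQ-divisor : ∀ d → primeToQ d ≡ divisorTerm x R d
  primeToQ-divisor d with q ∣? d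
  ... | yes q∣d with d ∣? R
  ...   | yes d∣R = ⊥-elim (q∤R (∣-trans q∣d d∣R))
  ...   | no  _   = refl
  primeToQ-divisor d | no q∤d with d ∣? q * n | d ∣? R
  ... | yes _    | yes _   = refl
  ... | yes d∣qn | no d∤R  =
    ⊥-elim (d∤R (∣-^*-cancel q-prime q∤d (suc K) R (subst (d ∣_) (sym (*-assoc q (q ^ K) R)) d∣qn)))
  ... | no d∤qn  | yes d∣R = ⊥-elim (d∤qn (∣-trans d∣R (∣-trans (n∣m*n (q ^ K)) (n∣m*n q))))
  ... | no _     | no _    = refl

  σ-prime-multiple : σ x (q * n) ≡ q ^ x * σ x n + σ x R
  σ-prime-multiple = begin
      σ x (q * n)
    ≡⟨ σ-as-sumBelow x (q * n) M qn<M ⟩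
      sumBelow (divisorTerm x (q * n)) M
    ≡⟨ sumBelow-cong M (λ d _ → split-term d) ⟩
      sumBelow (λ d → byQ d + primeToQ d) M
    ≡⟨ sumBelow-+ byQ primeToQ M ⟩
      sumBelow byQ M + sumBelow primeToQ M
    ≡⟨ cong₂ _+_ (sumBelow-stride q byQ (suc n) byQ-off)
                 (sumBelow-cong M (λ d _ → primeToQ-divisor d)) ⟩
      sumBelow (byQ ∘ (q *_)) (suc n) + sumBelow (divisorTerm x R) M
    ≡⟨ cong (_+ sumBelow (divisorTerm x R) M) (sumBelow-cong (suc n) (λ e _ → byQ-multiple e)) ⟩
      sumBelow (λ e → q ^ x * divisorTerm x n e) (suc n) + sumBelow (divisorTerm x R) M
    ≡⟨ cong (_+ sumBelow (divisorTerm x R) M) (sumBelow-scale (q ^ x) (divisorTerm x n) (suc n)) ⟩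
      q ^ x * sumBelow (divisorTerm x n) (suc n) + sumBelow (divisorTerm x R) M
    ≡⟨ cong₂ (λ a b → q ^ x * a + b) (σ-as-sumBelow x n (suc n) ≤-refl) (σ-as-sumBelow x R M R<M) ⟨
      q ^ x * σ x n + σ x R
    ∎

open PrimeMultiple using (σ-prime-multiple)

÷ℕ-<-⇔ : ∀ a b c d .{{_ : NonZero b}} .{{_ : NonZero d}} →
  (a ÷ℕ b ℚ.< c ÷ℕ d) ⇔ (a * d < c * b)
÷ℕ-<-⇔ a (suc b) c (suc d) = mk⇔ to from
  where
  u v : ℚᵘ.ℚᵘ
  u = ℚᵘ.mkℚᵘ (ℤ.+ a) b
  v = ℚᵘ.mkℚᵘ (ℤ.+ c) d
  to : ℚ.fromℚᵘ u ℚ.< ℚ.fromℚᵘ v → a * suc d < c * suc b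
  to u<v with ℚᵘₚ.<-respˡ-≃ (ℚₚ.toℚᵘ-fromℚᵘ u)
                (ℚᵘₚ.<-respʳ-≃ (ℚₚ.toℚᵘ-fromℚᵘ v) (ℚₚ.toℚᵘ-mono-< u<v))
  ... | ℚᵘ.*<* ad<cb = ℤₚ.+◃-cancel-< ad<cb
  from : a * suc d < c * suc b → ℚ.fromℚᵘ u ℚ.< ℚ.fromℚᵘ v
  from ad<cb = ℚₚ.toℚᵘ-cancel-< (ℚᵘₚ.<-respˡ-≃ (ℚᵘₚ.≃-sym (ℚₚ.toℚᵘ-fromℚᵘ u))
    (ℚᵘₚ.<-respʳ-≃ (ℚᵘₚ.≃-sym (ℚₚ.toℚᵘ-fromℚᵘ v)) (ℚᵘ.*<* (ℤₚ.+◃-mono-< ad<cb))))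

*-cancelʳ-<-⇔ : ∀ a b N .{{_ : NonZero N}} → (a * N < b * N) ⇔ (a < b)
*-cancelʳ-<-⇔ a b N = mk⇔ (*-cancelʳ-< N a b) (*-monoˡ-< N)

+-cancelˡ-<-⇔ : ∀ c a b → (c + a < c + b) ⇔ (a < b)
+-cancelˡ-<-⇔ c a b = mk⇔ (+-cancelˡ-< c a b) (+-monoʳ-< c)

divℕ-cancel : ∀ a b .{{_ : NonZero b}} → (b * a) divℕ b ≡ a
divℕ-cancel a (suc b) = trans (cong (_/ suc b) (*-comm (suc b) a)) (m*n/n≡m a (suc b))

prime-factor-criterion : ∀ x t .{{_ : NonZero t}} {q} → Prime q → ∀ K R → q ∤ R →
  let n = q ^ K * R in
  ((σ x n + t) ÷ℕ (n ^ x) ℚ.< I x (q * n)) ⇔ ((q ^ x) ÷ℕ 1 ℚ.< σ x (n divℕ (q ^ K)) ÷ℕ t)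
prime-factor-criterion x t {q} q-prime K R q∤R = begin
    (σ x n + t) ÷ℕ (n ^ x) ℚ.< σ x (q * n) ÷ℕ ((q * n) ^ x)
  ≈⟨ ÷ℕ-<-⇔ (σ x n + t) (n ^ x) (σ x (q * n)) ((q * n) ^ x) ⟩
    (σ x n + t) * (q * n) ^ x < σ x (q * n) * n ^ x
  ≡⟨ cong₂ (λ a b → (σ x n + t) * a < b * n ^ x)
            (^-distribʳ-* q n x) (σ-prime-multiple x q-prime K R q∤R) ⟩
    (σ x n + t) * (Q * n ^ x) < (Q * σ x n + σ x R) * n ^ x
  ≡⟨ cong (_< (Q * σ x n + σ x R) * n ^ x) distribute ⟩
    (Q * σ x n + Q * t) * n ^ x < (Q * σ x n + σ x R) * n ^ x
  ≈⟨ *-cancelʳ-<-⇔ (Q * σ x n + Q * t) (Q * σ x n + σ x R) (n ^ x) ⟩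
    Q * σ x n + Q * t < Q * σ x n + σ x R
  ≈⟨ +-cancelˡ-<-⇔ (Q * σ x n) (Q * t) (σ x R) ⟩
    Q * t < σ x R
  ≡⟨ cong (Q * t <_) (*-identityʳ (σ x R)) ⟨
    Q * t < σ x R * 1
  ≈⟨ ÷ℕ-<-⇔ Q 1 (σ x R) t ⟨
    Q ÷ℕ 1 ℚ.< σ x R ÷ℕ t
  ≡⟨ cong (λ m → Q ÷ℕ 1 ℚ.< σ x m ÷ℕ t) (divℕ-cancel R (q ^ K)) ⟨
    Q ÷ℕ 1 ℚ.< σ x (n divℕ (q ^ K)) ÷ℕ t
  ∎
  where
  open PrimeMultiple x q-prime K R q∤R using (n; qᴷ≢0; n≢0; qn≢0)
  open SetoidReasoning (⇔-setoid 0ℓ)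
  Q : ℕ
  Q = q ^ x
  instance
    nˣ≢0 : NonZero (n ^ x)
    nˣ≢0 = m^n≢0 n x
    [qn]ˣ≢0 : NonZero ((q * n) ^ x)
    [qn]ˣ≢0 = m^n≢0 (q * n) x
  distribute : (σ x n + t) * (Q * n ^ x) ≡ (Q * σ x n + Q * t) * n ^ x
  distribute = solve 4 (λ s t q m → (s :+ t) :* (q :* m) := (q :* s :+ q :* t) :* m) refl
    (σ x n) t Q (n ^ x)

mainTheorem12 : (x t : ℕ) → 1 ≤ x → 1 ≤ t →
    (s : ℕ) (p k : Fin s → ℕ) →
    (∀ i → Prime (p i)) → Injective _≡_ _≡_ p → (∀ i → 1 ≤ k i) →
    (n : ℕ) → n ≡ foldr (λ a b → a * b) 1 (λ i → p i ^ k i) →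
    (j : Fin s) →
    (((σ x n + t) ÷ℕ (n ^ x)) ℚ.< I x (p j * n))
    ⇔ ((p j ^ x) ÷ℕ 1 ℚ.< σ x (n divℕ (p j ^ k j)) ÷ℕ t)
mainTheorem12 x t _ 1≤t s p k p-prime p-inj _ n refl j
  with R , n≡pⱼᵏR , pⱼ∤R ← split-prime-power p k p-prime p-inj j
  rewrite n≡pⱼᵏR
  = prime-factor-criterion x t {{>-nonZero 1≤t}} (p-prime j) (k j) R pⱼ∤R
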